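{- For all $n\ge 3$, $\overline{q}_n(132,213,231,312)=2$.
   Context: For a positive integer $n$, let $\mathcal{S}_{n,n}$ denote the set of all permutations (words) $\pi=\pi_1\cdots\pi_{2n}$ of the multiset $\{1,1,2,2,\ldots,n,n\}$. A word $\pi$ contains a pattern $\sigma=\sigma_1\cdots\sigma_k$ if there are indices $i_1<\cdots<i_k$ such that $\pi_{i_a}=\pi_{i_b}$ iff $\sigma_a=\sigma_b$ and $\pi_{i_a}<\pi_{i_b}$ iff $\sigma_a<\sigma_b$ for all $a,b$; otherwise $\pi$ avoids $\sigma$. The quasi-Stirling permutations $\overline{\mathcal{Q}}_n$ are the $\pi\in\mathcal{S}_{n,n}$ avoiding both $1212$ and $2121$. For a set $\Lambda$ of patterns, $\overline{\mathcal{Q}}_n(\Lambda)$ is the set of $\pi\in\overline{\mathcal{Q}}_n$ avoiding every pattern in $\Lambda$, and $\overline{q}_n(\Lambda)=|\overline{\mathcal{Q}}_n(\Lambda)|$. -}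

module Defs where

open import Data.Nat using (ℕ; suc; _<_)
open import Data.List using (List; []; _∷_; length; lookup; concatMap; upTo; map)
open import Data.Fin using (Fin) renaming (_<_ to _<ᶠ_)
open import Data.Product using (Σ; _×_)
open import Data.Empty using (⊥)
open import Relation.Binary.PropositionalEquality using (_≡_)
open import Relation.Nullary using (¬_)
open import Function.Bundles using (_⇔_)
open import Data.List.Relation.Binary.Permutation.Propositional using (_↭_)
open import Data.List.Relation.Unary.All using (All)
open import Data.List.Relation.Unary.Unique.Propositional using (Unique)
open import Data.List.Membership.Propositional using (_∈_)

-- Words are lists of natural numbers; letters are 1..n.

doubled : ℕ → List ℕ
doubled n = concatMap (λ i → suc i ∷ suc i ∷ []) (upTo n)

InS : ℕ → List ℕ → Set
InS n π = π ↭ doubled n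

Contains : List ℕ → List ℕ → Set
Contains π σ =
  Σ (Fin (length σ) → Fin (length π)) λ f →
    (∀ a b → a <ᶠ b → f a <ᶠ f b) ×
    (∀ a b → (lookup π (f a) ≡ lookup π (f b) ⇔ lookup σ a ≡ lookup σ b)
           × (lookup π (f a) < lookup π (f b) ⇔ lookup σ a < lookup σ b))

Avoids : List ℕ → List ℕ → Set
Avoids π σ = ¬ Contains π σ

InQ : ℕ → List ℕ → Set
InQ n π = InS n π × Avoids π (1 ∷ 2 ∷ 1 ∷ 2 ∷ []) × Avoids π (2 ∷ 1 ∷ 2 ∷ 1 ∷ [])

InQΛ : ℕ → List (List ℕ) → List ℕ → Set
InQΛ n Λ π = InQ n π × All (Avoids π) Λ

HasCount : ℕ → List (List ℕ) → ℕ → Set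
HasCount n Λ k =
  Σ (List (List ℕ)) λ L → Unique L × length L ≡ k × (∀ π → (π ∈ L ⇔ InQΛ n Λ π))

-- Avoiding 132, 213, 231 and 312 says exactly that any three letters with distinct values occur
-- in increasing or in decreasing order. As soon as a word has three distinct letters it cannot
-- contain a return a … b … a: wherever a third letter c sits, two of the triples it forms with
-- the a's and b disagree about which value lies in the middle. So every triple is weakly monotone,
-- and a word all of whose triples are weakly monotone is sorted one way or the other. The only
-- sorted rearrangements of 1 1 2 2 … n n are the ascending and the descending one, and both
-- avoid all six patterns involved, since each pattern has both an ascent and a descent.

module Submission where

open import Defs
open import Data.Nat using (ℕ; zero; suc; _≤_; _<_; _≥_; _≟_; _≤?_; z≤n; s≤s)
open import Data.Nat.Properties
  using (<-irrefl; <-asym; <-trans; <-cmp; <⇒≤; <⇒≱; ≤-refl; ≤-trans; ≤-total; ≤-antisym; n≤1+n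
        ; ≤-totalOrder; ≤-decTotalOrder)
open import Data.Fin using (Fin; zero; suc) renaming (_<_ to _<ᶠ_)
import Data.Fin.Properties as Fin
open import Data.List using (List; []; _∷_; length; lookup)
open import Data.List.Relation.Unary.All as All using (All; []; _∷_)
open import Data.List.Relation.Unary.Any as Any using (here; there)
open import Data.List.Relation.Unary.Any.Properties using (lookup-index)
open import Data.List.Relation.Unary.AllPairs using ([]; _∷_)
open import Data.List.Relation.Unary.Linked using (Linked; []; [-]; _∷_)
open import Data.List.Relation.Unary.Linked.Properties using (Linked⇒All)
open import Data.List.Relation.Unary.Sorted.TotalOrder using (Sorted)
open import Data.List.Relation.Unary.Sorted.TotalOrder.Properties using (lookup-mono-≤; ↗↭↗⇒≋)
open import Data.List.Relation.Binary.Pointwise using (Pointwise-≡⇒≡)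
open import Data.List.Membership.Propositional using (_∈_)
open import Data.List.Relation.Binary.Permutation.Propositional using (_↭_; ↭-sym; ↭-trans; ↭⇒↭ₛ)
open import Data.List.Relation.Binary.Permutation.Propositional.Properties using (∈-resp-↭)
import Data.List.Sort as Sort
open import Data.Product using (∃-syntax; _×_; _,_; proj₂)
import Data.Product as Product
open import Data.Sum using (_⊎_; inj₁; inj₂; swap)
import Data.Sum as Sum
open import Data.Empty using (⊥; ⊥-elim)
open import Function using (flip; id; _∘_; _⇔_; mk⇔)
open import Function.Bundles using (module Equivalence)
open import Level using (Level; 0ℓ)
open import Relation.Nullary using (¬_; yes; no; contradiction)
open import Relation.Binary using (TotalOrder; DecTotalOrder; Rel; Transitive; Total; Decidable; Tri; tri<; tri≈; tri>)
import Relation.Binary.Construct.Flip.EqAndOrd as Flip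
open import Relation.Binary.PropositionalEquality using (_≡_; _≢_; refl; sym; trans; cong; subst; ≢-sym)

private
  variable
    a ℓ : Level
    A : Set a

Monotone : Rel A ℓ → A → A → A → Set ℓ
Monotone R x y z = (R x y × R y z) ⊎ (R y x × R z y)

Monotone-reverse : {R : Rel A ℓ} {x y z : A} → Monotone R x y z → Monotone R z y x
Monotone-reverse (inj₁ (xRy , yRz)) = inj₂ (yRz , xRy)
Monotone-reverse (inj₂ (yRx , zRy)) = inj₁ (zRy , yRx)

MonotoneTriples : Rel A ℓ → List A → Set ℓ
MonotoneTriples R xs =
  ∀ {i j k} → i <ᶠ j → j <ᶠ k → Monotone R (lookup xs i) (lookup xs j) (lookup xs k)

module _ {R : Rel A ℓ} (R-trans : Transitive R) (R-total : Total R) (R? : Decidable R) where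

  private
    R-refl : ∀ {x} → R x x
    R-refl {x} = Sum.[ id , id ] (R-total x x)

    ¬R⇒flip : ∀ {x y} → ¬ R x y → R y x
    ¬R⇒flip {x} {y} ¬xRy = Sum.[ (λ xRy → contradiction xRy ¬xRy) , id ] (R-total x y)

  All-equivalent⇒Linked-flip : ∀ {c xs} → All (λ w → R w c) xs → All (R c) xs → Linked (flip R) xs
  All-equivalent⇒Linked-flip [] [] = []
  All-equivalent⇒Linked-flip (_ ∷ []) (_ ∷ []) = [-]
  All-equivalent⇒Linked-flip (_ ∷ vRc ∷ ws) (cRu ∷ cs) =
    R-trans vRc cRu ∷ All-equivalent⇒Linked-flip (vRc ∷ ws) cs

  below-second : ∀ {x y zs} → ¬ R x y → MonotoneTriples R (x ∷ y ∷ zs) → All (λ z → R z y) zs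
  below-second {x} {y} {zs} ¬xRy mono = All.tabulate λ z∈zs →
    below (lookup-index z∈zs) (mono {zero} {suc zero} {suc (suc (Any.index z∈zs))} (s≤s z≤n) (s≤s (s≤s z≤n)))
    where
    below : ∀ {z l} → z ≡ lookup zs l → Monotone R x y (lookup zs l) → R z y
    below refl (inj₁ (xRy , _)) = contradiction xRy ¬xRy
    below refl (inj₂ (_ , zRy)) = zRy

  extend-sorted : ∀ {x y zs} → MonotoneTriples R (x ∷ y ∷ zs) → Linked R (y ∷ zs) →
                  Linked R (x ∷ y ∷ zs) ⊎ Linked (flip R) (x ∷ y ∷ zs)
  extend-sorted {x} {y} mono y↗ with R? x y
  ... | yes xRy = inj₁ (xRy ∷ y↗)
  ... | no ¬xRy = inj₂ (¬R⇒flip ¬xRy ∷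
          All-equivalent⇒Linked-flip (R-refl ∷ below-second ¬xRy mono) (Linked⇒All R-trans R-refl y↗))

monotoneTriples⇒sorted : {R : Rel A ℓ} → Transitive R → Total R → Decidable R →
                         ∀ xs → MonotoneTriples R xs → Linked R xs ⊎ Linked (flip R) xs
monotoneTriples⇒sorted _ _ _ [] _ = inj₁ []
monotoneTriples⇒sorted _ _ _ (x ∷ []) _ = inj₁ [-]
monotoneTriples⇒sorted R-trans R-total R? (x ∷ y ∷ zs) mono
  with monotoneTriples⇒sorted R-trans R-total R? (y ∷ zs) (λ i<j j<k → mono (s≤s i<j) (s≤s j<k))
... | inj₁ y↗ = extend-sorted R-trans R-total R? mono y↗
... | inj₂ y↘ = swap (extend-sorted (flip R-trans) (flip R-total) (flip R?) (λ i<j j<k → swap (mono i<j j<k)) y↘)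

OrderIsomorphic : ℕ → ℕ → ℕ → ℕ → Set
OrderIsomorphic u v s t = (u ≡ v ⇔ s ≡ t) × (u < v ⇔ s < t)

OrderIsomorphic-refl : ∀ {u s} → OrderIsomorphic u u s s
OrderIsomorphic-refl = mk⇔ (λ _ → refl) (λ _ → refl) , mk⇔ (⊥-elim ∘ <-irrefl refl) (⊥-elim ∘ <-irrefl refl)

SameOrder : ℕ → ℕ → ℕ → ℕ → Set
SameOrder u v s t = (u < v × s < t) ⊎ (v < u × t < s)

SameOrder⇒OrderIsomorphic : ∀ {u v s t} → SameOrder u v s t → OrderIsomorphic u v s t
SameOrder⇒OrderIsomorphic (inj₁ (u<v , s<t)) =
  mk⇔ (λ u≡v → ⊥-elim (<-irrefl u≡v u<v)) (λ s≡t → ⊥-elim (<-irrefl s≡t s<t)) ,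
  mk⇔ (λ _ → s<t) (λ _ → u<v)
SameOrder⇒OrderIsomorphic (inj₂ (v<u , t<s)) =
  mk⇔ (λ u≡v → ⊥-elim (<-irrefl (sym u≡v) v<u)) (λ s≡t → ⊥-elim (<-irrefl (sym s≡t) t<s)) ,
  mk⇔ (λ u<v → ⊥-elim (<-asym u<v v<u)) (λ s<t → ⊥-elim (<-asym s<t t<s))

contains-triple : ∀ π {i j k : Fin (length π)} {s₀ s₁ s₂} → i <ᶠ j → j <ᶠ k →
                  SameOrder (lookup π i) (lookup π j) s₀ s₁ →
                  SameOrder (lookup π j) (lookup π k) s₁ s₂ →
                  SameOrder (lookup π i) (lookup π k) s₀ s₂ →
                  Contains π (s₀ ∷ s₁ ∷ s₂ ∷ [])
contains-triple π {i} {j} {k} {s₀} {s₁} {s₂} i<j j<k ij jk ik = occurrence , occurrence-mono , isomorphic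
  where
  occurrence : Fin 3 → Fin (length π)
  occurrence zero = i
  occurrence (suc zero) = j
  occurrence (suc (suc zero)) = k
  occurrence-mono : ∀ a b → a <ᶠ b → occurrence a <ᶠ occurrence b
  occurrence-mono zero (suc zero) _ = i<j
  occurrence-mono zero (suc (suc zero)) _ = <-trans i<j j<k
  occurrence-mono (suc zero) (suc (suc zero)) _ = j<k
  occurrence-mono (suc zero) (suc zero) (s≤s ())
  occurrence-mono (suc (suc zero)) (suc (suc zero)) (s≤s (s≤s ()))
  occurrence-mono (suc (suc zero)) (suc zero) (s≤s ())
  isomorphic : ∀ a b → OrderIsomorphic (lookup π (occurrence a)) (lookup π (occurrence b))
                                       (lookup (s₀ ∷ s₁ ∷ s₂ ∷ []) a) (lookup (s₀ ∷ s₁ ∷ s₂ ∷ []) b)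
  isomorphic zero zero = OrderIsomorphic-refl
  isomorphic zero (suc zero) = SameOrder⇒OrderIsomorphic ij
  isomorphic zero (suc (suc zero)) = SameOrder⇒OrderIsomorphic ik
  isomorphic (suc zero) zero = SameOrder⇒OrderIsomorphic (swap ij)
  isomorphic (suc zero) (suc zero) = OrderIsomorphic-refl
  isomorphic (suc zero) (suc (suc zero)) = SameOrder⇒OrderIsomorphic jk
  isomorphic (suc (suc zero)) zero = SameOrder⇒OrderIsomorphic (swap ik)
  isomorphic (suc (suc zero)) (suc zero) = SameOrder⇒OrderIsomorphic (swap jk)
  isomorphic (suc (suc zero)) (suc (suc zero)) = OrderIsomorphic-refl

nonMonotone3 : List (List ℕ)
nonMonotone3 = (1 ∷ 3 ∷ 2 ∷ []) ∷ (2 ∷ 1 ∷ 3 ∷ []) ∷ (2 ∷ 3 ∷ 1 ∷ []) ∷ (3 ∷ 1 ∷ 2 ∷ []) ∷ []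

DistinctTriplesMonotone : List ℕ → Set
DistinctTriplesMonotone π = ∀ {i j k} → i <ᶠ j → j <ᶠ k →
  lookup π i ≢ lookup π j → lookup π j ≢ lookup π k → lookup π i ≢ lookup π k →
  Monotone _<_ (lookup π i) (lookup π j) (lookup π k)

avoids-nonMonotone3⇒distinctTriplesMonotone : ∀ {π} → All (Avoids π) nonMonotone3 → DistinctTriplesMonotone π
avoids-nonMonotone3⇒distinctTriplesMonotone {π} (a132 ∷ a213 ∷ a231 ∷ a312 ∷ []) {i} {j} {k} i<j j<k x≢y y≢z x≢z
  with <-cmp (lookup π i) (lookup π j) | <-cmp (lookup π j) (lookup π k) | <-cmp (lookup π i) (lookup π k)
... | tri≈ _ x≡y _ | _ | _ = contradiction x≡y x≢y
... | _ | tri≈ _ y≡z _ | _ = contradiction y≡z y≢z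
... | _ | _ | tri≈ _ x≡z _ = contradiction x≡z x≢z
... | tri< x<y _ _ | tri< y<z _ _ | _ = inj₁ (x<y , y<z)
... | tri> _ _ y<x | tri> _ _ z<y | _ = inj₂ (y<x , z<y)
... | tri< x<y _ _ | tri> _ _ z<y | tri< x<z _ _ =
  ⊥-elim (a132 (contains-triple π i<j j<k (inj₁ (x<y , n≤1+n 2)) (inj₂ (z<y , ≤-refl)) (inj₁ (x<z , ≤-refl))))
... | tri< x<y _ _ | tri> _ _ z<y | tri> _ _ z<x =
  ⊥-elim (a231 (contains-triple π i<j j<k (inj₁ (x<y , ≤-refl)) (inj₂ (z<y , n≤1+n 2)) (inj₂ (z<x , ≤-refl))))
... | tri> _ _ y<x | tri< y<z _ _ | tri< x<z _ _ =
  ⊥-elim (a213 (contains-triple π i<j j<k (inj₂ (y<x , ≤-refl)) (inj₁ (y<z , n≤1+n 2)) (inj₁ (x<z , ≤-refl))))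
... | tri> _ _ y<x | tri< y<z _ _ | tri> _ _ z<x =
  ⊥-elim (a312 (contains-triple π i<j j<k (inj₂ (y<x , n≤1+n 2)) (inj₁ (y<z , ≤-refl)) (inj₂ (z<x , ≤-refl))))

Monotone-<-middle-unique : ∀ {x y z} → Monotone _<_ x y z → Monotone _<_ x z y → ⊥
Monotone-<-middle-unique (inj₁ (_ , y<z)) (inj₁ (_ , z<y)) = <-asym y<z z<y
Monotone-<-middle-unique (inj₁ (x<y , y<z)) (inj₂ (z<x , _)) = <-asym x<y (<-trans y<z z<x)
Monotone-<-middle-unique (inj₂ (y<x , z<y)) (inj₁ (x<z , _)) = <-asym z<y (<-trans y<x x<z)
Monotone-<-middle-unique (inj₂ (_ , z<y)) (inj₂ (_ , y<z)) = <-asym y<z z<y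

distinctTriplesMonotone⇒no-return : ∀ {π} → DistinctTriplesMonotone π →
  ∀ {i j k c} → i <ᶠ j → j <ᶠ k → lookup π i ≡ lookup π k → lookup π i ≢ lookup π j →
  c ∈ π → c ≢ lookup π i → c ≢ lookup π j → ⊥
distinctTriplesMonotone⇒no-return {π} mono {i} {j} {k} {c} i<j j<k a≡a′ a≢b c∈π c≢a c≢b =
  placed (Fin.<-cmp p i) (Fin.<-cmp p j) (Fin.<-cmp p k)
  where
  p : Fin (length π)
  p = Any.index c∈π
  c-at-p : lookup π p ≡ c
  c-at-p = sym (lookup-index c∈π)
  a-at-k : lookup π k ≡ lookup π i
  a-at-k = sym a≡a′
  b≢a : lookup π j ≢ lookup π i
  b≢a = ≢-sym a≢b
  a≢c : lookup π i ≢ c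
  a≢c = ≢-sym c≢a
  b≢c : lookup π j ≢ c
  b≢c = ≢-sym c≢b
  reverse : ∀ {x y z} → Monotone _<_ x y z → Monotone _<_ z y x
  reverse = Monotone-reverse {R = _<_}

  at : ∀ {q r s x y z} → q <ᶠ r → r <ᶠ s → lookup π q ≡ x → lookup π r ≡ y → lookup π s ≡ z →
       x ≢ y → y ≢ z → x ≢ z → Monotone _<_ x y z
  at q<r r<s refl refl refl = mono q<r r<s

  placed : Tri (p <ᶠ i) (p ≡ i) (i <ᶠ p) → Tri (p <ᶠ j) (p ≡ j) (j <ᶠ p) → Tri (p <ᶠ k) (p ≡ k) (k <ᶠ p) → ⊥
  placed (tri< p<i _ _) _ _ = Monotone-<-middle-unique
    (at p<i i<j c-at-p refl refl c≢a a≢b c≢b)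
    (at (<-trans p<i i<j) j<k c-at-p refl a-at-k c≢b b≢a c≢a)
  placed (tri≈ _ p≡i _) _ _ = c≢a (trans (sym c-at-p) (cong (lookup π) p≡i))
  placed (tri> _ _ i<p) (tri< p<j _ _) _ = Monotone-<-middle-unique
    (at i<p p<j refl c-at-p refl a≢c c≢b a≢b)
    (reverse (at p<j j<k c-at-p refl a-at-k c≢b b≢a c≢a))
  placed _ (tri≈ _ p≡j _) _ = c≢b (trans (sym c-at-p) (cong (lookup π) p≡j))
  placed _ (tri> _ _ j<p) (tri< p<k _ _) = Monotone-<-middle-unique
    (at i<j j<p refl refl c-at-p a≢b b≢c a≢c)
    (reverse (at j<p p<k refl c-at-p a-at-k b≢c c≢a b≢a))
  placed _ _ (tri≈ _ p≡k _) = c≢a (trans (sym c-at-p) (trans (cong (lookup π) p≡k) a-at-k))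
  placed _ (tri> _ _ j<p) (tri> _ _ k<p) = Monotone-<-middle-unique
    (reverse (at i<j j<p refl refl c-at-p a≢b b≢c a≢c))
    (reverse (at j<k k<p refl a-at-k c-at-p b≢a a≢c b≢c))

HasThreeLetters : List ℕ → Set
HasThreeLetters π = ∀ a b → ∃[ c ] c ∈ π × c ≢ a × c ≢ b

three-letters : ∀ {π x y z} → x ∈ π → y ∈ π → z ∈ π → x ≢ y → y ≢ z → x ≢ z → HasThreeLetters π
three-letters {x = x} {y} {z} x∈π y∈π z∈π x≢y y≢z x≢z a b with x ≟ a | x ≟ b
... | no x≢a | no x≢b = x , x∈π , x≢a , x≢b
... | yes refl | _ with y ≟ b
...   | no y≢b = y , y∈π , ≢-sym x≢y , y≢b
...   | yes refl = z , z∈π , ≢-sym x≢z , ≢-sym y≢z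
three-letters {x = x} {y} {z} x∈π y∈π z∈π x≢y y≢z x≢z a b | no _ | yes refl with y ≟ a
...   | no y≢a = y , y∈π , y≢a , ≢-sym x≢y
...   | yes refl = z , z∈π , ≢-sym y≢z , ≢-sym x≢z

Monotone-≤-≡ˡ : ∀ {x y z} → x ≡ y → Monotone _≤_ x y z
Monotone-≤-≡ˡ {y = y} {z} refl = Sum.map (≤-refl ,_) (≤-refl ,_) (≤-total y z)

Monotone-≤-≡ʳ : ∀ {x y z} → y ≡ z → Monotone _≤_ x y z
Monotone-≤-≡ʳ {x} {y} refl = Sum.map (_, ≤-refl) (_, ≤-refl) (≤-total x y)

Monotone-<⇒≤ : ∀ {x y z} → Monotone _<_ x y z → Monotone _≤_ x y z
Monotone-<⇒≤ = Sum.map (Product.map <⇒≤ <⇒≤) (Product.map <⇒≤ <⇒≤)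

monotoneTriples-≤ : ∀ {π} → DistinctTriplesMonotone π → HasThreeLetters π → MonotoneTriples _≤_ π
monotoneTriples-≤ {π} mono third {i} {j} {k} i<j j<k
  with lookup π i ≟ lookup π j | lookup π j ≟ lookup π k | lookup π i ≟ lookup π k
... | yes x≡y | _ | _ = Monotone-≤-≡ˡ x≡y
... | no _ | yes y≡z | _ = Monotone-≤-≡ʳ y≡z
... | no x≢y | no y≢z | no x≢z = Monotone-<⇒≤ (mono i<j j<k x≢y y≢z x≢z)
... | no x≢y | no _ | yes x≡z with third (lookup π i) (lookup π j)
...   | c , c∈π , c≢x , c≢y = ⊥-elim (distinctTriplesMonotone⇒no-return mono i<j j<k x≡z x≢y c∈π c≢x c≢y)

≥-totalOrder : TotalOrder 0ℓ 0ℓ 0ℓ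
≥-totalOrder = Flip.totalOrder ≤-totalOrder

≥-decTotalOrder : DecTotalOrder 0ℓ 0ℓ 0ℓ
≥-decTotalOrder = Flip.decTotalOrder ≤-decTotalOrder

ascending-avoids-descent : ∀ {π σ} → Sorted ≤-totalOrder π →
                           ∀ a b → a <ᶠ b → lookup σ b < lookup σ a → Avoids π σ
ascending-avoids-descent π↗ a b a<b σb<σa (f , f-mono , isomorphic) =
  <⇒≱ (Equivalence.from (proj₂ (isomorphic b a)) σb<σa)
      (lookup-mono-≤ ≤-totalOrder π↗ (<⇒≤ (f-mono a b a<b)))

descending-avoids-ascent : ∀ {π σ} → Sorted ≥-totalOrder π →
                           ∀ a b → a <ᶠ b → lookup σ a < lookup σ b → Avoids π σ
descending-avoids-ascent π↘ a b a<b σa<σb (f , f-mono , isomorphic) =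
  <⇒≱ (Equivalence.from (proj₂ (isomorphic a b)) σa<σb)
      (lookup-mono-≤ ≥-totalOrder π↘ (<⇒≤ (f-mono a b a<b)))

-- Defined by sorting, so that being sorted and being a rearrangement of doubled n come for free.
module Ascending = Sort ≤-decTotalOrder
module Descending = Sort ≥-decTotalOrder

ascending : ℕ → List ℕ
ascending n = Ascending.sort (doubled n)

descending : ℕ → List ℕ
descending n = Descending.sort (doubled n)

ascending-inQΛ : ∀ n → InQΛ n nonMonotone3 (ascending n)
ascending-inQΛ n =
  (Ascending.sort-↭ (doubled n) , avoid (suc zero) (suc (suc zero)) ≤-refl ≤-refl , avoid zero (suc zero) ≤-refl ≤-refl) ,
  avoid (suc zero) (suc (suc zero)) ≤-refl ≤-refl ∷ avoid zero (suc zero) ≤-refl ≤-refl ∷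
  avoid (suc zero) (suc (suc zero)) ≤-refl (n≤1+n 2) ∷ avoid zero (suc zero) ≤-refl (n≤1+n 2) ∷ []
  where
  avoid : ∀ {σ} a b → a <ᶠ b → lookup σ b < lookup σ a → Avoids (ascending n) σ
  avoid {σ} = ascending-avoids-descent {σ = σ} (Ascending.sort-↗ (doubled n))

descending-inQΛ : ∀ n → InQΛ n nonMonotone3 (descending n)
descending-inQΛ n =
  (Descending.sort-↭ (doubled n) , avoid zero (suc zero) ≤-refl ≤-refl , avoid (suc zero) (suc (suc zero)) ≤-refl ≤-refl) ,
  avoid zero (suc zero) ≤-refl (n≤1+n 2) ∷ avoid (suc zero) (suc (suc zero)) ≤-refl (n≤1+n 2) ∷
  avoid zero (suc zero) ≤-refl ≤-refl ∷ avoid (suc zero) (suc (suc zero)) ≤-refl ≤-refl ∷ []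
  where
  avoid : ∀ {σ} a b → a <ᶠ b → lookup σ a < lookup σ b → Avoids (descending n) σ
  avoid {σ} = descending-avoids-ascent {σ = σ} (Descending.sort-↗ (doubled n))

ascending-unique : ∀ n {π} → Sorted ≤-totalOrder π → π ↭ doubled n → π ≡ ascending n
ascending-unique n π↗ π↭ = Pointwise-≡⇒≡
  (↗↭↗⇒≋ ≤-totalOrder π↗ (Ascending.sort-↗ _) (↭⇒↭ₛ (↭-trans π↭ (↭-sym (Ascending.sort-↭ _)))))

descending-unique : ∀ n {π} → Sorted ≥-totalOrder π → π ↭ doubled n → π ≡ descending n
descending-unique n π↘ π↭ = Pointwise-≡⇒≡
  (↗↭↗⇒≋ ≥-totalOrder π↘ (Descending.sort-↗ _) (↭⇒↭ₛ (↭-trans π↭ (↭-sym (Descending.sort-↭ _)))))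

sorted-both-ways⇒lookup-≡ : ∀ {xs} → Sorted ≤-totalOrder xs → Sorted ≥-totalOrder xs → ∀ i j → lookup xs i ≡ lookup xs j
sorted-both-ways⇒lookup-≡ xs↗ xs↘ i j with Fin.≤-total i j
... | inj₁ i≤j = ≤-antisym (lookup-mono-≤ ≤-totalOrder xs↗ i≤j) (lookup-mono-≤ ≥-totalOrder xs↘ i≤j)
... | inj₂ j≤i = ≤-antisym (lookup-mono-≤ ≥-totalOrder xs↘ j≤i) (lookup-mono-≤ ≤-totalOrder xs↗ j≤i)

sorted-both-ways⇒∈-≡ : ∀ {xs x y} → Sorted ≤-totalOrder xs → Sorted ≥-totalOrder xs → x ∈ xs → y ∈ xs → x ≡ y
sorted-both-ways⇒∈-≡ xs↗ xs↘ x∈xs y∈xs = trans (lookup-index x∈xs)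
  (trans (sorted-both-ways⇒lookup-≡ xs↗ xs↘ (Any.index x∈xs) (Any.index y∈xs)) (sym (lookup-index y∈xs)))

ascending≢descending : ∀ {n} → 2 ≤ n → ascending n ≢ descending n
ascending≢descending {suc (suc k)} (s≤s (s≤s _)) asc≡desc = 1≢2
  (sorted-both-ways⇒∈-≡ (Ascending.sort-↗ _) (subst (Sorted ≥-totalOrder) (sym asc≡desc) (Descending.sort-↗ _))
    (member (here refl)) (member (there (there (here refl)))))
  where
  member : ∀ {x} → x ∈ doubled (suc (suc k)) → x ∈ ascending (suc (suc k))
  member = ∈-resp-↭ (↭-sym (Ascending.sort-↭ _))
  1≢2 : 1 ≢ 2
  1≢2 ()

inQΛ⇒ascending⊎descending : ∀ {n π} → 3 ≤ n → InQΛ n nonMonotone3 π → π ≡ ascending n ⊎ π ≡ descending n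
inQΛ⇒ascending⊎descending {n@(suc (suc (suc k)))} {π} (s≤s (s≤s (s≤s _))) ((π↭ , _) , avoids) =
  Sum.map (λ π↗ → ascending-unique n π↗ π↭) (λ π↘ → descending-unique n π↘ π↭)
    (monotoneTriples⇒sorted ≤-trans ≤-total _≤?_ π
      (monotoneTriples-≤ (avoids-nonMonotone3⇒distinctTriplesMonotone {π} avoids) letters))
  where
  member : ∀ {x} → x ∈ doubled n → x ∈ π
  member = ∈-resp-↭ (↭-sym π↭)
  letters : HasThreeLetters π
  letters = three-letters (member (here refl)) (member (there (there (here refl))))
                          (member (there (there (there (there (here refl)))))) (λ ()) (λ ()) (λ ())

theorem4p17 : (n : ℕ) → n ≥ 3 →
    HasCount n ((1 ∷ 3 ∷ 2 ∷ []) ∷ (2 ∷ 1 ∷ 3 ∷ []) ∷ (2 ∷ 3 ∷ 1 ∷ []) ∷ (3 ∷ 1 ∷ 2 ∷ []) ∷ []) 2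
theorem4p17 n n≥3 =
  ascending n ∷ descending n ∷ [] ,
  (ascending≢descending (<⇒≤ n≥3) ∷ []) ∷ [] ∷ [] ,
  refl ,
  λ π → mk⇔ listed⇒inQΛ (classified⇒listed ∘ inQΛ⇒ascending⊎descending n≥3)
  where
  listed⇒inQΛ : ∀ {π} → π ∈ ascending n ∷ descending n ∷ [] → InQΛ n nonMonotone3 π
  listed⇒inQΛ (here refl) = ascending-inQΛ n
  listed⇒inQΛ (there (here refl)) = descending-inQΛ n
  classified⇒listed : ∀ {π} → π ≡ ascending n ⊎ π ≡ descending n → π ∈ ascending n ∷ descending n ∷ []
  classified⇒listed (inj₁ π≡ascending) = here π≡ascending
  classified⇒listed (inj₂ π≡descending) = there (here π≡descending)
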